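{- Let $d\ge 3$ and let $p,q$ be integers with $q\ge p\ge 0$ and $q>0$; let $S=[p,q]$. Let $\xi$ be a vertex of the infinite $d$-regular tree $\mathbb{T}_d$ and $L$ the link of $(\xi,\xi)$ in the polygraph $(\mathbb{T}_d)_S$. Then $L$ is connected if and only if $p$ is even and $q=2p$.
   Context: With $\rho$ the graph metric of $\mathbb{T}_d$, $(\mathbb{T}_d)_S$ has vertex set $V(\mathbb{T}_d)^2$, and $(x_1,x_2)\sim(y_1,y_2)$ iff $[\rho(x_1,y_1),\rho(x_2,y_2)]=[p,q]$ as multisets. The link of a vertex is the subgraph induced on its neighbours. (For a $d$-regular graph $G$ of girth larger than $3q$, every link of $G_S$ is isomorphic to $L$.) -}

module Defs where

open import Data.Nat using (ℕ; zero; suc; _∸_; _≤_)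
open import Data.Fin using (Fin)
open import Data.List using (List; []; _∷_)
open import Data.Maybe using (Maybe; nothing; just)
open import Data.Product using (_×_; _,_)
open import Data.Sum using (_⊎_)

-- Vertices of the infinite d-regular tree T_d, rooted at 'nothing'.
-- A non-root vertex 'just (i , js)' is reached from the root by first
-- stepping to child i (of d), then successively to children in
-- Fin (d ∸ 1) (the list is stored most-recent-step first).
-- Root has d neighbours (its children); every other vertex has d ∸ 1
-- children plus its parent, i.e. d neighbours.
Vertex : ℕ → Set
Vertex d = Maybe (Fin d × List (Fin (d ∸ 1)))

data Child {d : ℕ} : Vertex d → Vertex d → Set where
  root : (i : Fin d) → Child nothing (just (i , []))
  step : (i : Fin d) (j : Fin (d ∸ 1)) (js : List (Fin (d ∸ 1))) →
         Child (just (i , js)) (just (i , j ∷ js))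

Adj : {d : ℕ} → Vertex d → Vertex d → Set
Adj x y = Child x y ⊎ Child y x

data Walk {d : ℕ} : ℕ → Vertex d → Vertex d → Set where
  here : (x : Vertex d) → Walk zero x x
  there : {n : ℕ} {x y z : Vertex d} → Adj x y → Walk n y z → Walk (suc n) x z

Dist : {d : ℕ} → Vertex d → Vertex d → ℕ → Set
Dist {d} x y n = Walk n x y × ((m : ℕ) → Walk m x y → n ≤ m)

V2 : ℕ → Set
V2 d = Vertex d × Vertex d

-- Adjacency in (T_d)_S with S = [p,q] (equality of multisets)
PAdj : {d : ℕ} (p q : ℕ) → V2 d → V2 d → Set
PAdj p q (x₁ , x₂) (y₁ , y₂) =
  (Dist x₁ y₁ p × Dist x₂ y₂ q) ⊎ (Dist x₁ y₁ q × Dist x₂ y₂ p)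

InLink : {d : ℕ} (p q : ℕ) → Vertex d → V2 d → Set
InLink p q ξ v = PAdj p q (ξ , ξ) v

data LinkPath {d : ℕ} (p q : ℕ) (ξ : Vertex d) : V2 d → V2 d → Set where
  done : (u : V2 d) → LinkPath p q ξ u u
  next : {u w v : V2 d} → PAdj p q u w → InLink p q ξ w →
         LinkPath p q ξ w v → LinkPath p q ξ u v

LinkConnected : {d : ℕ} (p q : ℕ) (ξ : Vertex d) → Set
LinkConnected {d} p q ξ =
  (u v : V2 d) → InLink p q ξ u → InLink p q ξ v → LinkPath p q ξ u v

module Submission where

-- Reflections in edges and permutations of the branches at the root act
-- transitively on T_d, so ξ may be taken to be the root; a vertex of the link
-- is then a pair of vertices at depths (p , q) or (q , p). If q > 2p no edge of
-- the link joins these two depth profiles. If q < 2p the first coordinate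
-- never changes its branch at the root, since crossing the root from depth
-- at least p takes 2p > q steps. Summing parities along an edge shows that
-- p + q is even whenever the link has an edge. Conversely, for p = 2k and
-- q = 4k, two link vertices of profile (p , q) are joined as follows: the
-- shallow coordinate is moved through a third branch at the root (distance
-- 2p = q) while the deep one steps to a cousin at distance p and back; the
-- deep coordinate is moved by passing to profile (q , p), where it becomes
-- the shallow one.

open import Defs
open import Data.Nat using (ℕ; zero; suc; _≤_; _<_; _*_; _+_; _∸_; _⊓_; z≤n; s≤s; s≤s⁻¹; _≤?_)
open import Data.Nat.Properties
  using (≤-antisym; ≤-reflexive; ≤-trans; ≤-refl; n≤1+n; m≤m+n; +-monoˡ-≤; +-monoʳ-≤; +-mono-≤; +-suc;
         +-cancelˡ-≤; +-cancelʳ-≤; +-comm; +-identityʳ; *-comm; suc-injective; 0≢1+n; m≤n⇒m⊓n≡m;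
         m+n∸m≡n; <⇒≱; ≤-<-trans; <-cmp; module ≤-Reasoning)
open import Data.Nat.Divisibility using (_∣_; divides; ∣m∣n⇒∣m+n; ∣m+n∣m⇒∣n; _∣?_)
open import Data.Nat.Tactic.RingSolver using (solve-∀)
open import Data.Fin using (Fin; zero; suc) renaming (_≟_ to _≟ᶠ_)
open import Data.Fin.Permutation using (Permutation′; _⟨$⟩ʳ_; _⟨$⟩ˡ_; inverseˡ; inverseʳ; transpose)
open import Data.List using (List; []; _∷_; _++_; _∷ʳ_; length; replicate; take; drop; _∷ʳ′_; initLast)
open import Data.List.Properties using (++-identityʳ; ++-assoc; length-++; length-replicate; ++-cancelʳ; ∷ʳ-injectiveʳ; take++drop≡id; length-take; length-drop)
open import Data.Maybe using (nothing; just)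
open import Data.Maybe.Properties using (just-injective)
open import Data.Product using (_×_; _,_; proj₁; proj₂; ∃; ∃₂; swap)
open import Data.Sum using (_⊎_; inj₁; inj₂)
import Data.Sum as Sum
import Data.Product as Product
open import Data.Empty using (⊥-elim)
open import Relation.Nullary using (¬_; yes; no)
open import Relation.Nullary.Decidable using (decidable-stable; dec-true)
open import Relation.Binary.Definitions using (tri<; tri≈; tri>)
open import Relation.Binary.PropositionalEquality
open import Function using (_∘_)

split-at : ∀ {A : Set} a (xs : List A) {b} → length xs ≡ a + b →
           ∃₂ λ ks cs → xs ≡ ks ++ cs × length ks ≡ a × length cs ≡ b
split-at a xs {b} len = take a xs , drop a xs , sym (take++drop≡id a xs) ,
  trans (length-take a xs) (trans (cong (a ⊓_) len) (m≤n⇒m⊓n≡m (m≤m+n a b))) ,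
  trans (length-drop a xs) (trans (cong (_∸ a) len) (m+n∸m≡n a b))

module _ {d : ℕ} where

  Adj-sym : {x y : Vertex d} → Adj x y → Adj y x
  Adj-sym = Sum.swap

  infixl 5 _▷_
  infixr 5 _++ʷ_

  _▷_ : ∀ {n} {x y z : Vertex d} → Walk n x y → Adj y z → Walk (suc n) x z
  here _ ▷ a = there a (here _)
  there b w ▷ a = there b (w ▷ a)

  _++ʷ_ : ∀ {m n} {x y z : Vertex d} → Walk m x y → Walk n y z → Walk (m + n) x z
  here _ ++ʷ w = w
  there a v ++ʷ w = there a (v ++ʷ w)

  walk-reverse : ∀ {n} {x y : Vertex d} → Walk n x y → Walk n y x
  walk-reverse (here x) = here x
  walk-reverse (there a w) = walk-reverse w ▷ Adj-sym a

  Dist-sym : ∀ {n} {x y : Vertex d} → Dist x y n → Dist y x n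
  Dist-sym (w , minimal) = walk-reverse w , λ m w′ → minimal m (walk-reverse w′)

  Dist-cast : ∀ {m n} {x y : Vertex d} → m ≡ n → Dist x y m → Dist x y n
  Dist-cast refl h = h

  Dist-unique : ∀ {m n} {x y : Vertex d} → Dist x y m → Dist x y n → m ≡ n
  Dist-unique (v , v-min) (w , w-min) = ≤-antisym (v-min _ w) (w-min _ v)

  PAdj-sym : ∀ {p q} {u v : V2 d} → PAdj p q u v → PAdj p q v u
  PAdj-sym = Sum.map (Product.map Dist-sym Dist-sym) (Product.map Dist-sym Dist-sym)

  module _ {p q : ℕ} {ξ : Vertex d} where

    infixr 5 _++ᴸ_

    _++ᴸ_ : ∀ {u v w : V2 d} → LinkPath p q ξ u v → LinkPath p q ξ v w → LinkPath p q ξ u w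
    done _ ++ᴸ r = r
    next e h r ++ᴸ r′ = next e h (r ++ᴸ r′)

    LinkPath-reverse : ∀ {u v : V2 d} → InLink p q ξ u → LinkPath p q ξ u v → LinkPath p q ξ v u
    LinkPath-reverse hu (done _) = done _
    LinkPath-reverse hu (next e hw r) = LinkPath-reverse hw r ++ᴸ next (PAdj-sym e) hu (done _)

    PAdj-swap : ∀ {u v : V2 d} → PAdj p q u v → PAdj p q (swap u) (swap v)
    PAdj-swap {_ , _} {_ , _} (inj₁ (a , b)) = inj₂ (b , a)
    PAdj-swap {_ , _} {_ , _} (inj₂ (a , b)) = inj₁ (b , a)

    LinkPath-swap : ∀ {u v : V2 d} → LinkPath p q ξ u v → LinkPath p q ξ (swap u) (swap v)
    LinkPath-swap (done _) = done _
    LinkPath-swap (next e h r) = next (PAdj-swap e) (PAdj-swap h) (LinkPath-swap r)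

    LinkPath-invariant : (I : V2 d → Set) →
      (∀ {u w : V2 d} → InLink p q ξ u → I u → PAdj p q u w → InLink p q ξ w → I w) →
      ∀ {u v : V2 d} → InLink p q ξ u → I u → LinkPath p q ξ u v → I v
    LinkPath-invariant I preserved hu iu (done _) = iu
    LinkPath-invariant I preserved hu iu (next e hw r) = LinkPath-invariant I preserved hw (preserved hu iu e hw) r

    LinkPath-first-edge : ∀ {u v : V2 d} → LinkPath p q ξ u v → u ≢ v → ∃ λ w → PAdj p q u w × InLink p q ξ w
    LinkPath-first-edge (done _) u≢u = ⊥-elim (u≢u refl)
    LinkPath-first-edge (next e hw _) _ = _ , e , hw

  depth : Vertex d → ℕ
  depth nothing = 0
  depth (just (_ , js)) = suc (length js)

  Adj-depth : {x y : Vertex d} → Adj x y → depth y ≡ suc (depth x) ⊎ depth x ≡ suc (depth y)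
  Adj-depth (inj₁ (root _)) = inj₁ refl
  Adj-depth (inj₁ (step _ _ _)) = inj₁ refl
  Adj-depth (inj₂ (root _)) = inj₂ refl
  Adj-depth (inj₂ (step _ _ _)) = inj₂ refl

  Adj-depth-≤ : {x y : Vertex d} → Adj x y → depth y ≤ suc (depth x)
  Adj-depth-≤ a with Adj-depth a
  ... | inj₁ eq = ≤-reflexive eq
  ... | inj₂ eq = ≤-trans (n≤1+n _) (≤-trans (≤-reflexive (sym eq)) (n≤1+n _))

  walk-depth : ∀ {n} {x y : Vertex d} → Walk n x y → depth y ≤ depth x + n
  walk-depth (here x) = m≤m+n (depth x) 0
  walk-depth {suc n} {x} {z} (there {y = y} a w) = begin
    depth z           ≤⟨ walk-depth w ⟩
    depth y + n       ≤⟨ +-monoˡ-≤ n (Adj-depth-≤ a) ⟩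
    suc (depth x) + n ≡⟨ +-suc (depth x) n ⟨
    depth x + suc n   ∎
    where open ≤-Reasoning

  Dist-depth : ∀ {n} {x y : Vertex d} → Dist x y n → depth y ≤ depth x + n
  Dist-depth = walk-depth ∘ proj₁

  walk-parity : ∀ {n} {x y : Vertex d} → Walk n x y → 2 ∣ depth x + n + depth y
  walk-parity (here x) = divides (depth x) (double (depth x))
    where
    double : ∀ a → a + 0 + a ≡ a * 2
    double = solve-∀
  walk-parity {suc n} {x} {z} (there {y = y} a w) with Adj-depth a
  ... | inj₁ dy = subst (2 ∣_) (trans (cong (λ k → k + n + depth z) dy) (descend (depth x) n (depth z))) (walk-parity w)
    where
    descend : ∀ a n b → suc a + n + b ≡ a + suc n + b
    descend = solve-∀
  ... | inj₂ dx = subst (2 ∣_) (trans (ascend (depth y) n (depth z)) (cong (λ k → k + suc n + depth z) (sym dx)))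
                    (∣m∣n⇒∣m+n (walk-parity w) (divides 1 refl))
    where
    ascend : ∀ a n b → (a + n + b) + 2 ≡ suc a + suc n + b
    ascend = solve-∀

  Dist-parity : ∀ {n} {x y : Vertex d} → Dist x y n → 2 ∣ depth x + n + depth y
  Dist-parity = walk-parity ∘ proj₁

  walk-down : ∀ i (ks cs : List (Fin (d ∸ 1))) → Walk (length ks) (just (i , cs)) (just (i , ks ++ cs))
  walk-down i [] cs = here _
  walk-down i (k ∷ ks) cs = walk-down i ks cs ▷ inj₁ (step i k (ks ++ cs))

  walk-from-root : ∀ v → Walk (depth v) nothing v
  walk-from-root nothing = here _
  walk-from-root (just (i , js)) =
    there (inj₁ (root i)) (subst (λ ks → Walk (length js) _ (just (i , ks))) (++-identityʳ js) (walk-down i js []))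

  Dist-root : ∀ v → Dist nothing v (depth v)
  Dist-root v = walk-from-root v , λ m w → walk-depth w

  Dist-root⇒depth : ∀ {n} {v : Vertex d} → Dist nothing v n → depth v ≡ n
  Dist-root⇒depth {v = v} = Dist-unique (Dist-root v)

  depth⇒Dist-root : ∀ {n} {v : Vertex d} → depth v ≡ n → Dist nothing v n
  depth⇒Dist-root {v = v} refl = Dist-root v

  HasDepths : ℕ → ℕ → V2 d → Set
  HasDepths a b (x , y) = depth x ≡ a × depth y ≡ b

  InLink-root-depths : ∀ {p q} {w : V2 d} → InLink p q nothing w → HasDepths p q w ⊎ HasDepths q p w
  InLink-root-depths {w = _ , _} = Sum.map (Product.map Dist-root⇒depth Dist-root⇒depth)
                                           (Product.map Dist-root⇒depth Dist-root⇒depth)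

  Dist-ancestor : ∀ i (ks cs : List (Fin (d ∸ 1))) → Dist (just (i , ks ++ cs)) (just (i , cs)) (length ks)
  Dist-ancestor i ks cs = walk-reverse (walk-down i ks cs) , λ m w →
    +-cancelˡ-≤ (length cs) _ _ (begin
      length cs + length ks ≡⟨ +-comm (length cs) (length ks) ⟩
      length ks + length cs ≡⟨ length-++ ks ⟨
      length (ks ++ cs)     ≤⟨ s≤s⁻¹ (walk-depth (walk-reverse w)) ⟩
      length cs + m         ∎)
    where open ≤-Reasoning

  InSubtree : Fin d → List (Fin (d ∸ 1)) → Vertex d → Set
  InSubtree i cs v = ∃ λ ks → v ≡ just (i , ks ++ cs)

  exit-edge : ∀ {i cs} {x y : Vertex d} → Adj x y → InSubtree i cs x → ¬ InSubtree i cs y →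
              depth x ≡ suc (length cs) × depth y ≡ length cs
  exit-edge (inj₁ (root _)) (_ , ()) _
  exit-edge (inj₁ (step i j js)) (ks , refl) y∉ = ⊥-elim (y∉ (j ∷ ks , refl))
  exit-edge {cs = []} (inj₂ (root _)) ([] , refl) _ = refl , refl
  exit-edge {cs = _ ∷ _} (inj₂ (root _)) ([] , ()) _
  exit-edge (inj₂ (root _)) (_ ∷ _ , ()) _
  exit-edge (inj₂ (step _ _ _)) ([] , refl) _ = refl , refl
  exit-edge (inj₂ (step _ _ _)) (_ ∷ ks , refl) y∉ = ⊥-elim (y∉ (ks , refl))

  -- The bound is decidable, so it may be proved classically: either the
  -- walk leaves the subtree at its first edge, or it is still (not not)
  -- inside after one step.
  walk-leaving-subtree : ∀ {n i cs} {x y : Vertex d} → Walk n x y →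
    ¬ ¬ InSubtree i cs x → ¬ InSubtree i cs y → depth x + depth y ≤ n + (length cs + length cs)
  walk-leaving-subtree (here _) x∈ y∉ = ⊥-elim (x∈ y∉)
  walk-leaving-subtree {suc n} {i} {cs} {x} {z} (there {y = y} a w) x∈ z∉ =
    decidable-stable (_ ≤? _) λ short → short (continue (λ y∉ → x∈ (λ x∈′ → short (exit x∈′ y∉))))
    where
    c = length cs
    open ≤-Reasoning

    exit : InSubtree i cs x → ¬ InSubtree i cs y → depth x + depth z ≤ suc n + (c + c)
    exit x∈′ y∉ = let (dx , dy) = exit-edge a x∈′ y∉ in begin
      depth x + depth z       ≤⟨ +-monoʳ-≤ (depth x) (walk-depth w) ⟩
      depth x + (depth y + n) ≡⟨ cong₂ (λ k l → k + (l + n)) dx dy ⟩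
      suc c + (c + n)         ≡⟨ rearrange c n ⟩
      suc n + (c + c)         ∎
      where
      rearrange : ∀ c n → suc c + (c + n) ≡ suc n + (c + c)
      rearrange = solve-∀

    continue : ¬ ¬ InSubtree i cs y → depth x + depth z ≤ suc n + (c + c)
    continue y∈ = begin
      depth x + depth z       ≤⟨ +-monoˡ-≤ (depth z) (Adj-depth-≤ (Adj-sym a)) ⟩
      suc (depth y + depth z) ≤⟨ s≤s (walk-leaving-subtree w y∈ z∉) ⟩
      suc n + (c + c)         ∎

  ∷-middle-injective : ∀ {A : Set} (xs ys : List A) {x y : A} {zs : List A} →
                       xs ++ x ∷ zs ≡ ys ++ y ∷ zs → x ≡ y
  ∷-middle-injective xs ys {x} {y} {zs} eq = ∷ʳ-injectiveʳ xs ys (++-cancelʳ zs (xs ∷ʳ x) (ys ∷ʳ y) (begin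
    (xs ∷ʳ x) ++ zs ≡⟨ ++-assoc xs (x ∷ []) zs ⟩
    xs ++ x ∷ zs    ≡⟨ eq ⟩
    ys ++ y ∷ zs    ≡⟨ ++-assoc ys (y ∷ []) zs ⟨
    (ys ∷ʳ y) ++ zs ∎))
    where open ≡-Reasoning

  walk-down-past : ∀ i (ks : List (Fin (d ∸ 1))) j cs →
                   Walk (suc (length ks)) (just (i , cs)) (just (i , ks ++ j ∷ cs))
  walk-down-past i ks j cs = there (inj₁ (step i j cs)) (walk-down i ks (j ∷ cs))

  Dist-fork : ∀ i (ks ks′ : List (Fin (d ∸ 1))) {j j′} cs → j ≢ j′ →
    Dist (just (i , ks ++ j ∷ cs)) (just (i , ks′ ++ j′ ∷ cs)) (suc (length ks) + suc (length ks′))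
  Dist-fork i ks ks′ {j} {j′} cs j≢j′ =
    walk-reverse (walk-down-past i ks j cs) ++ʷ walk-down-past i ks′ j′ cs , λ m w →
    +-cancelʳ-≤ (suc c + suc c) _ _ (begin
      (suc a + suc b) + (suc c + suc c)     ≡⟨ rearrange a b c ⟨
      suc (a + suc c) + suc (b + suc c)     ≡⟨ cong₂ (λ k l → suc k + suc l) (length-++ ks) (length-++ ks′) ⟨
      depth (just (i , ks ++ j ∷ cs)) + depth (just (i , ks′ ++ j′ ∷ cs))
                                            ≤⟨ walk-leaving-subtree w (λ x∉ → x∉ (ks , refl)) y∉ ⟩
      m + (suc c + suc c)                   ∎)
    where
    a = length ks
    b = length ks′
    c = length cs
    open ≤-Reasoning

    rearrange : ∀ a b c → suc (a + suc c) + suc (b + suc c) ≡ (suc a + suc b) + (suc c + suc c)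
    rearrange = solve-∀

    y∉ : ¬ InSubtree i (j ∷ cs) (just (i , ks′ ++ j′ ∷ cs))
    y∉ (ks″ , eq) = j≢j′ (sym (∷-middle-injective ks′ ks″ (cong proj₂ (just-injective eq))))

  Dist-across-root : ∀ {i i′} (ks ks′ : List (Fin (d ∸ 1))) → i ≢ i′ →
    Dist (just (i , ks)) (just (i′ , ks′)) (suc (length ks) + suc (length ks′))
  Dist-across-root {i} {i′} ks ks′ i≢i′ =
    walk-reverse (walk-from-root (just (i , ks))) ++ʷ walk-from-root (just (i′ , ks′)) , λ m w → begin
      suc (length ks) + suc (length ks′) ≤⟨ walk-leaving-subtree {cs = []} w x∈ y∉ ⟩
      m + 0                              ≡⟨ +-identityʳ m ⟩
      m                                  ∎
    where
    open ≤-Reasoning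

    x∈ : ¬ ¬ InSubtree i [] (just (i , ks))
    x∈ x∉ = x∉ (ks , cong (λ l → just (i , l)) (sym (++-identityʳ ks)))

    y∉ : ¬ InSubtree i [] (just (i′ , ks′))
    y∉ (_ , eq) = i≢i′ (sym (cong proj₁ (just-injective eq)))

  ancestor-at : ∀ {a s} (v : Vertex d) → depth v ≡ a + suc s → ∃ λ v′ → depth v′ ≡ suc s × Dist v v′ a
  ancestor-at {a} {s} nothing eq = ⊥-elim (0≢1+n (trans eq (+-suc a s)))
  ancestor-at {a} {s} (just (i , js)) eq with split-at a js (suc-injective (trans eq (+-suc a s)))
  ... | ks , cs , refl , refl , refl = just (i , cs) , refl , Dist-ancestor i ks cs

record Automorphism (d : ℕ) : Set where
  field
    to from : Vertex d → Vertex d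
    from∘to : ∀ v → from (to v) ≡ v
    to∘from : ∀ v → to (from v) ≡ v
    to-adj : {x y : Vertex d} → Adj x y → Adj (to x) (to y)
    from-adj : {x y : Vertex d} → Adj x y → Adj (from x) (from y)

open Automorphism

module _ {d : ℕ} where

  id-automorphism : Automorphism d
  id-automorphism = record
    { to = λ v → v ; from = λ v → v ; from∘to = λ _ → refl ; to∘from = λ _ → refl
    ; to-adj = λ a → a ; from-adj = λ a → a }

  inverse : Automorphism d → Automorphism d
  inverse A = record
    { to = from A ; from = to A ; from∘to = to∘from A ; to∘from = from∘to A
    ; to-adj = from-adj A ; from-adj = to-adj A }

  infixr 9 _∘ᴬ_

  _∘ᴬ_ : Automorphism d → Automorphism d → Automorphism d
  B ∘ᴬ A = record
    { to = to B ∘ to A ; from = from A ∘ from B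
    ; from∘to = λ v → trans (cong (from A) (from∘to B (to A v))) (from∘to A v)
    ; to∘from = λ v → trans (cong (to B) (to∘from A (from B v))) (to∘from B v)
    ; to-adj = to-adj B ∘ to-adj A ; from-adj = from-adj A ∘ from-adj B }

  walk-map : ∀ (A : Automorphism d) {n} {x y : Vertex d} → Walk n x y → Walk n (to A x) (to A y)
  walk-map A (here x) = here _
  walk-map A (there a w) = there (to-adj A a) (walk-map A w)

  Dist-map : ∀ (A : Automorphism d) {n} {x y : Vertex d} → Dist x y n → Dist (to A x) (to A y) n
  Dist-map A {x = x} {y} (w , minimal) = walk-map A w , λ m w′ →
    minimal m (subst₂ (Walk m) (from∘to A x) (from∘to A y) (walk-map (inverse A) w′))

  to² : Automorphism d → V2 d → V2 d
  to² A (x , y) = to A x , to A y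

  PAdj-map : ∀ (A : Automorphism d) {p q} {u v : V2 d} → PAdj p q u v → PAdj p q (to² A u) (to² A v)
  PAdj-map A {u = _ , _} {_ , _} = Sum.map (Product.map (Dist-map A) (Dist-map A)) (Product.map (Dist-map A) (Dist-map A))

  LinkPath-map : ∀ (A : Automorphism d) {p q ξ} {u v : V2 d} → LinkPath p q ξ u v →
                 LinkPath p q (to A ξ) (to² A u) (to² A v)
  LinkPath-map A (done _) = done _
  LinkPath-map A (next e h r) = next (PAdj-map A e) (PAdj-map A h) (LinkPath-map A r)

  LinkConnected-transport : ∀ {p q ξ} (A : Automorphism d) → LinkConnected p q ξ → LinkConnected p q (to A ξ)
  LinkConnected-transport {p} {q} {ξ} A connected u v hu hv =
    subst₂ (LinkPath p q (to A ξ)) (to∘from² u) (to∘from² v)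
      (LinkPath-map A (connected _ _ (pull hu) (pull hv)))
    where
    to∘from² : ∀ w → to² A (to² (inverse A) w) ≡ w
    to∘from² (x , y) = cong₂ _,_ (to∘from A x) (to∘from A y)

    pull : ∀ {w} → InLink p q (to A ξ) w → InLink p q ξ (to² (inverse A) w)
    pull h = subst (λ z → PAdj p q (z , z) _) (from∘to A ξ) (PAdj-map (inverse A) h)

initLast-∷ʳ : ∀ {A : Set} (xs : List A) x → initLast (xs ∷ʳ x) ≡ xs ∷ʳ′ x
initLast-∷ʳ [] x = refl
initLast-∷ʳ (y ∷ xs) x rewrite initLast-∷ʳ xs x = refl

root-neighbour : ∀ {d} {v : Vertex d} → Adj nothing v → ∃ λ i → v ≡ just (i , [])
root-neighbour (inj₁ (root i)) = i , refl

module _ {d : ℕ} where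

  -- The reflection of the tree in the edge between the root and just (zero , []).
  flip : Vertex (suc d) → Vertex (suc d)
  flip nothing = just (zero , [])
  flip (just (suc i , js)) = just (zero , js ∷ʳ i)
  flip (just (zero , js)) with initLast js
  ... | [] = nothing
  ... | ks ∷ʳ′ k = just (suc k , ks)

  flip-involutive : ∀ v → flip (flip v) ≡ v
  flip-involutive nothing = refl
  flip-involutive (just (suc i , js)) rewrite initLast-∷ʳ js i = refl
  flip-involutive (just (zero , js)) with initLast js
  ... | [] = refl
  ... | ks ∷ʳ′ k = refl

  flip-child : {x y : Vertex (suc d)} → Child x y → Adj (flip x) (flip y)
  flip-child (root zero) = inj₂ (root zero)
  flip-child (root (suc i)) = inj₁ (step zero i [])
  flip-child (step (suc i) j js) = inj₁ (step zero j (js ∷ʳ i))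
  flip-child (step zero j js) with initLast js
  ... | [] = inj₁ (root (suc j))
  ... | ks ∷ʳ′ k = inj₁ (step (suc k) j ks)

  flip-adj : {x y : Vertex (suc d)} → Adj x y → Adj (flip x) (flip y)
  flip-adj (inj₁ c) = flip-child c
  flip-adj (inj₂ c) = Adj-sym (flip-child c)

  flip-automorphism : Automorphism (suc d)
  flip-automorphism = record
    { to = flip ; from = flip ; from∘to = flip-involutive ; to∘from = flip-involutive
    ; to-adj = flip-adj ; from-adj = flip-adj }

  relabel : (Fin (suc d) → Fin (suc d)) → Vertex (suc d) → Vertex (suc d)
  relabel π nothing = nothing
  relabel π (just (i , js)) = just (π i , js)

  relabel-adj : ∀ π {x y : Vertex (suc d)} → Adj x y → Adj (relabel π x) (relabel π y)
  relabel-adj π (inj₁ (root i)) = inj₁ (root (π i))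
  relabel-adj π (inj₁ (step i j js)) = inj₁ (step (π i) j js)
  relabel-adj π (inj₂ (root i)) = inj₂ (root (π i))
  relabel-adj π (inj₂ (step i j js)) = inj₂ (step (π i) j js)

  relabel-inverse : ∀ {π ρ : Fin (suc d) → Fin (suc d)} → (∀ i → π (ρ i) ≡ i) → ∀ v → relabel π (relabel ρ v) ≡ v
  relabel-inverse π∘ρ nothing = refl
  relabel-inverse π∘ρ (just (i , js)) = cong (λ k → just (k , js)) (π∘ρ i)

  permute-branches : Permutation′ (suc d) → Automorphism (suc d)
  permute-branches π = record
    { to = relabel (π ⟨$⟩ʳ_) ; from = relabel (π ⟨$⟩ˡ_)
    ; from∘to = relabel-inverse (λ _ → inverseˡ π) ; to∘from = relabel-inverse (λ _ → inverseʳ π)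
    ; to-adj = relabel-adj _ ; from-adj = relabel-adj _ }

  root-neighbour-to-root : ∀ i → ∃ λ (A : Automorphism (suc d)) → to A (just (i , [])) ≡ nothing
  root-neighbour-to-root i = flip-automorphism ∘ᴬ permute-branches (transpose i zero) ,
    cong (λ k → flip (just (k , []))) (transpose-sends i zero)
    where
    transpose-sends : ∀ i j → transpose i j ⟨$⟩ʳ i ≡ j
    transpose-sends i j rewrite dec-true (i ≟ᶠ i) refl = refl

  -- By induction along the path from the root: the parent is sent to the
  -- root, hence the vertex itself to a neighbour of the root.
  to-root : ∀ v → ∃ λ (A : Automorphism (suc d)) → to A v ≡ nothing
  to-root nothing = id-automorphism , refl
  to-root (just (i , [])) = root-neighbour-to-root i
  to-root (just (i , j ∷ js)) =
    let (A , parent↦root) = to-root (just (i , js))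
        (i′ , v↦i′) = root-neighbour (subst (λ z → Adj z (to A (just (i , j ∷ js)))) parent↦root (to-adj A (inj₁ (step i j js))))
        (B , i′↦root) = root-neighbour-to-root i′
    in B ∘ᴬ A , trans (cong (to B) v↦i′) i′↦root

module Tree (e : ℕ) where

  D : ℕ
  D = suc (suc (suc e))

  V : Set
  V = Vertex D

  other : Fin (suc (suc e)) → Fin (suc (suc e))
  other zero = suc zero
  other (suc _) = zero

  other-≢ : ∀ j → j ≢ other j
  other-≢ zero ()
  other-≢ (suc _) ()

  third : Fin D → Fin D → Fin D
  third zero zero = suc zero
  third zero (suc zero) = suc (suc zero)
  third zero (suc (suc _)) = suc zero
  third (suc _) (suc _) = zero
  third (suc zero) zero = suc (suc zero)
  third (suc (suc _)) zero = suc zero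

  third-≢ˡ : ∀ a b → a ≢ third a b
  third-≢ˡ zero zero ()
  third-≢ˡ zero (suc zero) ()
  third-≢ˡ zero (suc (suc _)) ()
  third-≢ˡ (suc _) (suc _) ()
  third-≢ˡ (suc zero) zero ()
  third-≢ˡ (suc (suc _)) zero ()

  third-≢ʳ : ∀ a b → third a b ≢ b
  third-≢ʳ zero zero ()
  third-≢ʳ zero (suc zero) ()
  third-≢ʳ zero (suc (suc _)) ()
  third-≢ʳ (suc _) (suc _) ()
  third-≢ʳ (suc zero) zero ()
  third-≢ʳ (suc (suc _)) zero ()

  zeros : ℕ → List (Fin (suc (suc e)))
  zeros n = replicate n zero

  -- From v, climb t + 1 levels to the ancestor at depth s + 1, then descend
  -- l + 1 levels into a different child subtree.
  fork : ∀ {t s} (v : V) l → depth v ≡ suc t + suc s →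
         ∃ λ v′ → depth v′ ≡ suc l + suc s × Dist v v′ (suc t + suc l)
  fork {t} {s} nothing l ()
  fork {t} {s} (just (i , js)) l eq with split-at t js (suc-injective eq)
  ... | ks , [] , _ , _ , ()
  ... | ks , j ∷ cs , refl , refl , refl =
    just (i , zeros l ++ other j ∷ cs) ,
    cong suc (trans (length-++ (zeros l)) (cong (_+ suc (length cs)) (length-replicate l))) ,
    Dist-cast (cong (λ k → suc (length ks) + suc k) (length-replicate l))
      (Dist-fork i ks (zeros l) cs (other-≢ j))

  through-root : ∀ {a b} {u w : V} → depth u ≡ suc a → depth w ≡ suc b → ∀ c →
                 ∃ λ v → depth v ≡ suc c × Dist u v (suc a + suc c) × Dist v w (suc c + suc b)
  through-root {u = just (i , ks)} {just (i′ , ks′)} refl refl c =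
    just (third i i′ , zeros c) ,
    cong suc (length-replicate c) ,
    Dist-cast (cong (λ k → suc (length ks) + suc k) (length-replicate c))
      (Dist-across-root ks (zeros c) (third-≢ˡ i i′)) ,
    Dist-cast (cong (λ k → suc k + suc (length ks′)) (length-replicate c))
      (Dist-across-root (zeros c) ks′ (third-≢ʳ i i′))

  on-branch : Fin D → ℕ → V
  on-branch i zero = nothing
  on-branch i (suc n) = just (i , zeros n)

  depth-on-branch : ∀ i n → depth (on-branch i n) ≡ n
  depth-on-branch i zero = refl
  depth-on-branch i (suc n) = cong suc (length-replicate n)

  on-branch-InSubtree : ∀ i n → 0 < n → InSubtree i [] (on-branch i n)
  on-branch-InSubtree i (suc n) _ = zeros n , cong (λ l → just (i , l)) (sym (++-identityʳ (zeros n)))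

  on-branch₀≢on-branch₁ : ∀ n → 0 < n → on-branch zero n ≢ on-branch (suc zero) n
  on-branch₀≢on-branch₁ (suc n) _ ()

  on-branch₁-∉-subtree₀ : ∀ n → ¬ InSubtree zero [] (on-branch (suc zero) n)
  on-branch₁-∉-subtree₀ zero (_ , ())
  on-branch₁-∉-subtree₀ (suc n) (_ , ())

  module Balanced (m : ℕ) where

    k P Q : ℕ
    k = suc m
    P = k + k
    Q = P + P

    3k+k≡2k+2k : ∀ k → (k + k + k) + k ≡ (k + k) + (k + k)
    3k+k≡2k+2k = solve-∀

    k+3k≡2k+2k : ∀ k → k + (k + k + k) ≡ (k + k) + (k + k)
    k+3k≡2k+2k = solve-∀

    inLink : {x y : V} → depth x ≡ P → depth y ≡ Q → InLink P Q nothing (x , y)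
    inLink hx hy = inj₁ (depth⇒Dist-root hx , depth⇒Dist-root hy)

    inLink-swapped : {x y : V} → depth x ≡ Q → depth y ≡ P → InLink P Q nothing (x , y)
    inLink-swapped hx hy = inj₂ (depth⇒Dist-root hx , depth⇒Dist-root hy)

    descendant : {u : V} → depth u ≡ P → ∃ λ u′ → depth u′ ≡ Q × Dist u u′ Q
    descendant {u} hu =
      let (u′ , hu′ , uu′) = fork {t = m} {s = m} u (m + k + k) hu
      in u′ , trans hu′ (3k+k≡2k+2k k) , Dist-cast (k+3k≡2k+2k k) uu′

    cousin : {v : V} → depth v ≡ Q → ∃ λ v′ → depth v′ ≡ Q × Dist v v′ P
    cousin {v} hv =
      let (v′ , hv′ , vv′) = fork {t = m} {s = m + k + k} v m (trans hv (sym (k+3k≡2k+2k k)))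
      in v′ , trans hv′ (k+3k≡2k+2k k) , vv′

    ancestor : {v : V} → depth v ≡ Q → ∃ λ v′ → depth v′ ≡ P × Dist v v′ P
    ancestor {v} = ancestor-at v

    detour : {u w : V} → depth u ≡ P → depth w ≡ P → ∃ λ v → depth v ≡ P × Dist u v Q × Dist v w Q
    detour hu hw = through-root hu hw (m + k)

    change-shallow : {u u′ v : V} → depth u ≡ P → depth u′ ≡ P → depth v ≡ Q →
                     LinkPath P Q nothing (u , v) (u′ , v)
    change-shallow hu hu′ hv =
      let (w , hw , uw , wu′) = detour hu hu′
          (v′ , hv′ , vv′) = cousin hv
      in next (inj₂ (uw , vv′)) (inLink hw hv′) (next (inj₂ (wu′ , Dist-sym vv′)) (inLink hu′ hv) (done _))

    change-deep : {u v v′ : V} → depth u ≡ P → depth v ≡ Q → depth v′ ≡ Q →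
                  LinkPath P Q nothing (u , v) (u , v′)
    change-deep hu hv hv′ =
      let (u₁ , hu₁ , uu₁) = descendant hu
          (a , ha , va) = ancestor hv
          (a′ , ha′ , v′a′) = ancestor hv′
      in next (inj₂ (uu₁ , va)) (inLink-swapped hu₁ ha)
           (LinkPath-swap (change-shallow ha ha′ hu₁) ++ᴸ
            next (inj₂ (Dist-sym uu₁ , Dist-sym v′a′)) (inLink hu hv′) (done _))

    reach-shallow-first : {w : V2 D} → InLink P Q nothing w →
                          ∃₂ λ x y → depth x ≡ P × depth y ≡ Q × LinkPath P Q nothing w (x , y)
    reach-shallow-first {x , y} h with InLink-root-depths h
    ... | inj₁ (hx , hy) = x , y , hx , hy , done _
    ... | inj₂ (hx , hy) =
      let (a , ha , xa) = ancestor hx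
          (y′ , hy′ , yy′) = descendant hy
      in a , y′ , ha , hy′ , next (inj₁ (xa , yy′)) (inLink ha hy′) (done _)

    connected : LinkConnected P Q nothing
    connected u v hu hv =
      let (x , y , hx , hy , u⇝xy) = reach-shallow-first hu
          (x′ , y′ , hx′ , hy′ , v⇝x′y′) = reach-shallow-first hv
      in u⇝xy ++ᴸ change-shallow hx hx′ hy ++ᴸ change-deep hx′ hy hy′ ++ᴸ LinkPath-reverse hv v⇝x′y′

  module RootLink {p q : ℕ} (p≤q : p ≤ q) where

    Link : V2 D → Set
    Link = InLink p q nothing

    2*p≡p+p : 2 * p ≡ p + p
    2*p≡p+p = cong (p +_) (+-identityʳ p)

    edge-walk : {x y x′ y′ : V} → PAdj p q (x , y) (x′ , y′) → ∃ λ r → r ≤ q × Walk r x x′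
    edge-walk (inj₁ (d₁ , _)) = p , p≤q , proj₁ d₁
    edge-walk (inj₂ (d₁ , _)) = q , ≤-refl , proj₁ d₁

    link-depth : {w : V2 D} → Link w → p ≤ depth (proj₁ w)
    link-depth {_ , _} h with InLink-root-depths h
    ... | inj₁ (hx , _) = ≤-reflexive (sym hx)
    ... | inj₂ (hx , _) = ≤-trans p≤q (≤-reflexive (sym hx))

    link-depth-sum : {w : V2 D} → Link w → depth (proj₁ w) + depth (proj₂ w) ≡ p + q
    link-depth-sum {_ , _} h with InLink-root-depths h
    ... | inj₁ (hx , hy) = cong₂ _+_ hx hy
    ... | inj₂ (hx , hy) = trans (cong₂ _+_ hx hy) (+-comm q p)

    u₀ : V2 D
    u₀ = on-branch zero p , on-branch zero q

    u₀-depths : HasDepths p q u₀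
    u₀-depths = depth-on-branch zero p , depth-on-branch zero q

    u₀∈link : Link u₀
    u₀∈link = inj₁ (depth⇒Dist-root (proj₁ u₀-depths) , depth⇒Dist-root (proj₂ u₀-depths))

    q≰p+p : 2 * p < q → ¬ q ≤ p + p
    q≰p+p 2p<q q≤p+p = <⇒≱ 2p<q (subst (q ≤_) (sym 2*p≡p+p) q≤p+p)

    -- For q > 2 p an edge cannot join the depth profiles (p , q) and (q , p):
    -- some coordinate would move between depths p and q along distance p.
    depths-preserved : 2 * p < q → ∀ {u w : V2 D} → Link u → HasDepths p q u → PAdj p q u w → Link w →
                       HasDepths p q w
    depths-preserved 2p<q {x , y} {x′ , y′} _ (hx , hy) e hw with InLink-root-depths hw | e
    ... | inj₁ h | _ = h
    ... | inj₂ (hx′ , _) | inj₁ (d₁ , _) = ⊥-elim (q≰p+p 2p<q (subst₂ (λ a b → a ≤ b + p) hx′ hx (Dist-depth d₁)))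
    ... | inj₂ (_ , hy′) | inj₂ (_ , d₂) = ⊥-elim (q≰p+p 2p<q (subst₂ (λ a b → a ≤ b + p) hy hy′ (Dist-depth (Dist-sym d₂))))

    disconnected-if-q>2p : 2 * p < q → ¬ LinkConnected p q nothing
    disconnected-if-q>2p 2p<q connected = q≰p+p 2p<q (subst (_≤ p + p) (sym q≡p) (m≤m+n p p))
      where
      target : V2 D
      target = on-branch zero q , on-branch zero p

      target∈link : Link target
      target∈link = inj₂ (depth⇒Dist-root (depth-on-branch zero q) , depth⇒Dist-root (depth-on-branch zero p))

      q≡p : q ≡ p
      q≡p = trans (sym (depth-on-branch zero q))
        (proj₁ (LinkPath-invariant (HasDepths p q) (depths-preserved 2p<q) u₀∈link u₀-depths
                  (connected u₀ target u₀∈link target∈link)))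

    InBranch₀ : V2 D → Set
    InBranch₀ (x , _) = ¬ ¬ InSubtree zero [] x

    -- For q < 2 p a first coordinate cannot cross the root: both ends have
    -- depth at least p, so the crossing would need a walk of length 2 p > q.
    branch-preserved : q < 2 * p → ∀ {u w : V2 D} → Link u → InBranch₀ u → PAdj p q u w → Link w →
                       InBranch₀ w
    branch-preserved q<2p {x , _} {x′ , _} hu x∈ e hw x′∉ =
      let (r , r≤q , walk) = edge-walk e in
      <⇒≱ q<2p (begin
        2 * p              ≡⟨ 2*p≡p+p ⟩
        p + p              ≤⟨ +-mono-≤ (link-depth hu) (link-depth hw) ⟩
        depth x + depth x′ ≤⟨ walk-leaving-subtree walk x∈ x′∉ ⟩
        r + 0              ≡⟨ +-identityʳ r ⟩
        r                  ≤⟨ r≤q ⟩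
        q                  ∎)
      where open ≤-Reasoning

    disconnected-if-q<2p : q < 2 * p → ¬ LinkConnected p q nothing
    disconnected-if-q<2p q<2p connected =
      LinkPath-invariant InBranch₀ (branch-preserved q<2p) u₀∈link (λ x∉ → x∉ (on-branch-InSubtree zero p 0<p))
        (connected u₀ target u₀∈link target∈link) (on-branch₁-∉-subtree₀ p)
      where
      0<p : 0 < p
      0<p = half-positive p (≤-<-trans z≤n q<2p)
        where
        half-positive : ∀ n → 0 < 2 * n → 0 < n
        half-positive (suc n) _ = s≤s z≤n

      target : V2 D
      target = on-branch (suc zero) p , on-branch zero q

      target∈link : Link target
      target∈link = inj₁ (depth⇒Dist-root (depth-on-branch (suc zero) p) , depth⇒Dist-root (depth-on-branch zero q))

    -- Adding the parity constraints of the two coordinate moves of an edge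
    -- gives 2 ∣ 3 (p + q): the depths at each end and the two distances all
    -- add up to p + q.
    link-edge-parity : ∀ {u w : V2 D} → Link u → Link w → PAdj p q u w → 2 ∣ p + q
    link-edge-parity {x , y} {x′ , y′} hu hw e =
      ∣m+n∣m⇒∣n (Sum.[ (λ (d₁ , d₂) → moves d₁ d₂ refl) , (λ (d₁ , d₂) → moves d₁ d₂ (+-comm q p)) ] e)
                (divides (p + q) (twice (p + q)))
      where
      twice : ∀ n → n + n ≡ n * 2
      twice = solve-∀

      rearrange : ∀ a r a′ b t b′ → (a + r + a′) + (b + t + b′) ≡ (a + b) + (r + t) + (a′ + b′)
      rearrange = solve-∀

      moves : ∀ {r₁ r₂} → Dist x x′ r₁ → Dist y y′ r₂ → r₁ + r₂ ≡ p + q → 2 ∣ (p + q) + (p + q) + (p + q)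
      moves {r₁} {r₂} d₁ d₂ r₁+r₂ =
        subst (2 ∣_)
          (trans (rearrange (depth x) r₁ (depth x′) (depth y) r₂ (depth y′))
                 (cong₂ _+_ (cong₂ _+_ (link-depth-sum hu) r₁+r₂) (link-depth-sum hw)))
          (∣m∣n⇒∣m+n (Dist-parity d₁) (Dist-parity d₂))

    disconnected-if-odd : 0 < q → ¬ 2 ∣ p + q → ¬ LinkConnected p q nothing
    disconnected-if-odd 0<q odd connected =
      let (w , e , hw) = LinkPath-first-edge (connected u₀ target u₀∈link target∈link) u₀≢target
      in odd (link-edge-parity u₀∈link hw e)
      where
      target : V2 D
      target = on-branch zero p , on-branch (suc zero) q

      target∈link : Link target
      target∈link = inj₁ (depth⇒Dist-root (depth-on-branch zero p) , depth⇒Dist-root (depth-on-branch (suc zero) q))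

      u₀≢target : u₀ ≢ target
      u₀≢target = on-branch₀≢on-branch₁ q 0<q ∘ cong proj₂

    connected⇒balanced : 0 < q → LinkConnected p q nothing → 2 ∣ p × q ≡ 2 * p
    connected⇒balanced 0<q connected with <-cmp q (2 * p)
    ... | tri< q<2p _ _ = ⊥-elim (disconnected-if-q<2p q<2p connected)
    ... | tri> _ _ q>2p = ⊥-elim (disconnected-if-q>2p q>2p connected)
    ... | tri≈ _ q≡2p _ with 2 ∣? p
    ...   | yes 2∣p = 2∣p , q≡2p
    ...   | no 2∤p = ⊥-elim (disconnected-if-odd 0<q (2∤p ∘ halve) connected)
      where
      halve : 2 ∣ p + q → 2 ∣ p
      halve 2∣p+q = ∣m+n∣m⇒∣n (subst (2 ∣_) (trans (cong (p +_) q≡2p) (+-comm p (2 * p))) 2∣p+q)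
                              (divides p (*-comm 2 p))

  balanced⇒connected : ∀ {p q} → 0 < q → 2 ∣ p → q ≡ 2 * p → LinkConnected {D} p q nothing
  balanced⇒connected 0<q (divides zero refl) refl = ⊥-elim (<⇒≱ 0<q z≤n)
  balanced⇒connected _ (divides (suc m) refl) refl =
    subst₂ (λ a b → LinkConnected {D} a b nothing) (sym p≡P) (sym q≡Q) connected
    where
    open Balanced m
    p≡P : suc m * 2 ≡ P
    p≡P = trans (*-comm (suc m) 2) (cong (k +_) (+-identityʳ k))
    q≡Q : 2 * (suc m * 2) ≡ Q
    q≡Q = trans (cong (2 *_) p≡P) (cong (P +_) (+-identityʳ P))

claim3p6 : (d : ℕ) → 3 ≤ d → (p q : ℕ) → p ≤ q → 0 < q → (ξ : Vertex d) →
    (LinkConnected p q ξ → (2 ∣ p × q ≡ 2 * p)) ×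
    ((2 ∣ p × q ≡ 2 * p) → LinkConnected p q ξ)
claim3p6 (suc (suc (suc e))) (s≤s (s≤s (s≤s z≤n))) p q p≤q 0<q ξ =
  (λ connected → connected⇒balanced 0<q (subst (LinkConnected p q) ξ↦root (LinkConnected-transport A connected))) ,
  (λ (2∣p , q≡2p) → subst (LinkConnected p q) root↦ξ
                      (LinkConnected-transport (inverse A) (balanced⇒connected 0<q 2∣p q≡2p)))
  where
  open Tree e
  open RootLink p≤q

  A : Automorphism D
  A = proj₁ (to-root ξ)

  ξ↦root : to A ξ ≡ nothing
  ξ↦root = proj₂ (to-root ξ)

  root↦ξ : from A nothing ≡ ξ
  root↦ξ = trans (cong (from A) (sym ξ↦root)) (from∘to A ξ)
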